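{- Let $G$ be a CNF formula whose variables lie in a finite set $Z$, let $z\in Z$, and suppose $G$ has no $\{z\}$-removable boundary point. Let $C$ be a $\{z\}$-clause of $G$ (a clause of $G$ containing the variable $z$). Then the CNF formula $G'=G\setminus\{C\}$ (obtained by removing $C$ from $G$) has no $\{z\}$-removable boundary point.
   Context: A point is a complete assignment to $Z$. For $Z'\subseteq Z$, a clause is a $Z'$-clause if it contains a variable of $Z'$, and a non-$Z'$-clause otherwise. A point $\boldsymbol{p}$ is a $Z'$-boundary point of a CNF formula $H$ if $H(\boldsymbol{p})=0$, every clause of $H$ falsified by $\boldsymbol{p}$ is a $Z'$-clause, and this property fails for every proper subset of $Z'$. A point $\boldsymbol{p}$ is a $Z'$-removable boundary point of $H$ if $\boldsymbol{p}$ is a $Z''$-boundary point of $H$ for some $Z''\subseteq Z'$ and there exists a clause $D$ falsified by $\boldsymbol{p}$ that is a non-$Z'$-clause and is implied by the conjunction of the $Z'$-clauses of $H$. -}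

module Defs where

open import Data.Nat using (ℕ)
open import Data.Bool using (Bool; true; false)
open import Data.Fin using (Fin)
open import Data.Fin.Subset using (Subset; _∈_; _⊆_; _⊂_)
open import Data.Product using (Σ; ∃-syntax; _×_)
open import Data.Sum using (_⊎_)
open import Data.List using (List; filter)
open import Data.List.Relation.Unary.All using (All)
import Data.List.Membership.Propositional as LM
open import Relation.Nullary using (¬_; ¬?)
open import Relation.Binary.PropositionalEquality using (_≡_)
open import Relation.Binary.Definitions using (DecidableEquality)
import Data.Vec.Properties as VP
import Data.Bool.Properties as BP
import Data.Product.Properties as PP

-- A point: a complete assignment to the variable set Z = Fin n.
Point : ℕ → Set
Point n = Fin n → Bool

-- A clause: a set of literals, given as (positive variables, negative variables).
Clause : ℕ → Set
Clause n = Subset n × Subset n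

pos : ∀ {n} → Clause n → Subset n
pos = Data.Product.proj₁

neg : ∀ {n} → Clause n → Subset n
neg = Data.Product.proj₂

_≟C_ : ∀ {n} → DecidableEquality (Clause n)
_≟C_ = PP.≡-dec (VP.≡-dec BP._≟_) (VP.≡-dec BP._≟_)

CNF : ℕ → Set
CNF n = List (Clause n)

Sat : ∀ {n} → Point n → Clause n → Set
Sat p C = ∃[ v ] ((v ∈ pos C × p v ≡ true) ⊎ (v ∈ neg C × p v ≡ false))

Falsifies : ∀ {n} → Point n → Clause n → Set
Falsifies p C = ¬ Sat p C

EvalFalse : ∀ {n} → CNF n → Point n → Set
EvalFalse H p = ¬ All (Sat p) H

IsZClause : ∀ {n} → Subset n → Clause n → Set
IsZClause Z' C = ∃[ v ] (v ∈ Z' × (v ∈ pos C ⊎ v ∈ neg C))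

FalsifiedAreZClauses : ∀ {n} → CNF n → Point n → Subset n → Set
FalsifiedAreZClauses H p Z' = ∀ D → D LM.∈ H → Falsifies p D → IsZClause Z' D

IsBoundaryPoint : ∀ {n} → CNF n → Point n → Subset n → Set
IsBoundaryPoint H p Z' =
  EvalFalse H p × FalsifiedAreZClauses H p Z'
    × (∀ Z'' → Z'' ⊂ Z' → ¬ FalsifiedAreZClauses H p Z'')

ZClausesImply : ∀ {n} → CNF n → Subset n → Clause n → Set
ZClausesImply H Z' D =
  ∀ (q : Point _) → (∀ E → E LM.∈ H → IsZClause Z' E → Sat q E) → Sat q D

IsRemovableBoundaryPoint : ∀ {n} → CNF n → Point n → Subset n → Set
IsRemovableBoundaryPoint {n} H p Z' =
  (Σ (Subset n) λ Z'' → Z'' ⊆ Z' × IsBoundaryPoint H p Z'')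
  × (Σ (Clause n) λ D → Falsifies p D × ¬ IsZClause Z' D × ZClausesImply H Z' D)

removeClause : ∀ {n} → CNF n → Clause n → CNF n
removeClause G C = filter (λ D → ¬? (D ≟C C)) G

module Submission where

-- Proof idea: a {z}-removable boundary point p of G' is one of G as well.
--   * G' ⊆ G, so G(p) = 0, every Z''-cover of the clauses of G falsified by
--     p is one for G' (minimality transfers), and the {z}-clauses of G imply
--     at least what those of G' imply (the removable clause D transfers).
--   * The boundary set Z'' ⊆ {z} cannot be empty, since G'(p) = 0 forces
--     some falsified clause, which must mention a variable of Z''.  Hence
--     Z'' = {z}, so C is a Z''-clause and the only new falsified clause C
--     is covered by Z''.

open import Defs
open import Level using (0ℓ)
open import Data.Nat using (ℕ)
open import Data.Fin using (Fin)
open import Data.Fin.Subset using (Subset; ⁅_⁆; Empty)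
  renaming (_∈_ to _∈ˢ_; _⊆_ to _⊆ˢ_)
open import Data.Fin.Subset.Properties using (x∈⁅y⁆⇒x≡y; _∈?_)
open import Data.Product using (∃-syntax; _,_; proj₁)
open import Data.List.Relation.Unary.All using (tabulate; lookup; sequenceM)
open import Data.List.Membership.Propositional using (_∈_)
open import Data.List.Membership.Propositional.Properties using (∈-filter⁺; ∈-filter⁻)
open import Data.List.Relation.Binary.Subset.Propositional using (_⊆_)
open import Relation.Nullary using (¬_; ¬?; yes; no)
open import Relation.Nullary.Negation using (¬¬-Monad; contradiction)
open import Relation.Binary.PropositionalEquality using (_≢_; refl; sym; subst)

removeClause-⊆ : ∀ {n} (G : CNF n) (C : Clause n) → removeClause G C ⊆ G
removeClause-⊆ G C D∈G' = proj₁ (∈-filter⁻ (λ D → ¬? (D ≟C C)) D∈G')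

∈-removeClause : ∀ {n} {G : CNF n} {C D : Clause n} →
  D ∈ G → D ≢ C → D ∈ removeClause G C
∈-removeClause {C = C} D∈G D≢C = ∈-filter⁺ (λ D → ¬? (D ≟C C)) D∈G D≢C

evalFalse-mono : ∀ {n} {H H' : CNF n} {p : Point n} →
  H ⊆ H' → EvalFalse H p → EvalFalse H' p
evalFalse-mono H⊆H' H[p]=0 satH' = H[p]=0 (tabulate λ D∈H → lookup satH' (H⊆H' D∈H))

falsifiedAreZClauses-antimono : ∀ {n} {H H' : CNF n} {p : Point n} {Z : Subset n} →
  H ⊆ H' → FalsifiedAreZClauses H' p Z → FalsifiedAreZClauses H p Z
falsifiedAreZClauses-antimono H⊆H' cover D D∈H = cover D (H⊆H' D∈H)

zClausesImply-mono : ∀ {n} {H H' : CNF n} {Z : Subset n} {D : Clause n} →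
  H ⊆ H' → ZClausesImply H Z D → ZClausesImply H' Z D
zClausesImply-mono H⊆H' implies q satZH' =
  implies q (λ E E∈H → satZH' E (H⊆H' E∈H))

isZClause-mono : ∀ {n} {Z Z' : Subset n} {C : Clause n} →
  Z ⊆ˢ Z' → IsZClause Z C → IsZClause Z' C
isZClause-mono Z⊆Z' (v , v∈Z , v∈C) = v , Z⊆Z' v∈Z , v∈C

-- If H(p) = 0 and every clause falsified by p is a Z-clause, Z is non-empty:
-- otherwise no clause of H could be falsified, i.e. p would satisfy H.
-- (Constructively we only get ¬¬ Sat per clause, which suffices since the
-- conclusion is negative and ¬¬ commutes with finite conjunctions.)

falsified-nonempty : ∀ {n} {H : CNF n} {p : Point n} {Z : Subset n} →
  EvalFalse H p → FalsifiedAreZClauses H p Z → ¬ Empty Z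
falsified-nonempty {H = H} {p} H[p]=0 cover Z-empty =
  sequenceM 0ℓ ¬¬-Monad (tabulate notFalsified) H[p]=0
  where
  notFalsified : ∀ {D} → D ∈ H → ¬ ¬ Sat p D
  notFalsified D∈H falsified =
    let (v , v∈Z , _) = cover _ D∈H falsified in Z-empty (v , v∈Z)

nonempty-⊆⁅⁆ : ∀ {n} {Z : Subset n} (z : Fin n) → Z ⊆ˢ ⁅ z ⁆ → ¬ Empty Z → z ∈ˢ Z
nonempty-⊆⁅⁆ {Z = Z} z Z⊆z nonempty with z ∈? Z
... | yes z∈Z = z∈Z
... | no  z∉Z = contradiction Z-empty nonempty
  where
  Z-empty : Empty Z
  Z-empty (v , v∈Z) = z∉Z (subst (_∈ˢ Z) (x∈⁅y⁆⇒x≡y z (Z⊆z v∈Z)) v∈Z)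

⁅⁆-⊆ : ∀ {n} {Z : Subset n} {z : Fin n} → z ∈ˢ Z → ⁅ z ⁆ ⊆ˢ Z
⁅⁆-⊆ {Z = Z} {z} z∈Z v∈⁅z⁆ = subst (_∈ˢ Z) (sym (x∈⁅y⁆⇒x≡y z v∈⁅z⁆)) z∈Z

-- Re-inserting a Z-clause C preserves Z-boundary points: C is the only clause
-- that may become falsified, and it is covered by Z.

falsifiedAreZClauses-insert : ∀ {n} {G : CNF n} {C : Clause n} {p : Point n} {Z : Subset n} →
  FalsifiedAreZClauses (removeClause G C) p Z → IsZClause Z C →
  FalsifiedAreZClauses G p Z
falsifiedAreZClauses-insert {C = C} cover C-isZ D D∈G falsified with D ≟C C
... | yes refl = C-isZ
... | no  D≢C  = cover D (∈-removeClause D∈G D≢C) falsified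

boundaryPoint-insert : ∀ {n} {G : CNF n} {C : Clause n} {p : Point n} {Z : Subset n} →
  IsBoundaryPoint (removeClause G C) p Z → IsZClause Z C → IsBoundaryPoint G p Z
boundaryPoint-insert {G = G} {C} (G'[p]=0 , cover , minimal) C-isZ =
    evalFalse-mono G'⊆G G'[p]=0
  , falsifiedAreZClauses-insert cover C-isZ
  , λ Z' Z'⊂Z coverG → minimal Z' Z'⊂Z (falsifiedAreZClauses-antimono G'⊆G coverG)
  where
  G'⊆G : removeClause G C ⊆ G
  G'⊆G = removeClause-⊆ G C

-- The proposition: a {z}-removable boundary point of G \ {C} is one of G.

proposition5 : (n : ℕ) (G : CNF n) (z : Fin n) →
    ¬ (∃[ p ] IsRemovableBoundaryPoint G p ⁅ z ⁆) →
    (C : Clause n) → C ∈ G → IsZClause ⁅ z ⁆ C →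
    ¬ (∃[ p ] IsRemovableBoundaryPoint (removeClause G C) p ⁅ z ⁆)
proposition5 _ G z noRemovable C _ C-isZ
  (p , (Z'' , Z''⊆z , boundary@(G'[p]=0 , cover , _)) , (D , falsified , D-notZ , implied)) =
  noRemovable (p , (Z'' , Z''⊆z , boundaryG) , (D , falsified , D-notZ , impliedG))
  where
  -- Z'' is non-empty, hence equal to {z}, so C is a Z''-clause.
  z∈Z'' : z ∈ˢ Z''
  z∈Z'' = nonempty-⊆⁅⁆ z Z''⊆z (falsified-nonempty G'[p]=0 cover)

  boundaryG : IsBoundaryPoint G p Z''
  boundaryG = boundaryPoint-insert boundary (isZClause-mono (⁅⁆-⊆ z∈Z'') C-isZ)

  impliedG : ZClausesImply G ⁅ z ⁆ D
  impliedG = zClausesImply-mono (removeClause-⊆ G C) implied
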